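{- A triangle-free graph $G$ is competitively tight if and only if $|V(G)| \geq 2$ and $G$ satisfies one of the following: (i) $G$ has no isolated vertices and $|E(G)| \geq |V(G)|-1$; (ii) $G$ has isolated vertices and $|E(G)| \geq |V(G)|-2$.
   Context: All graphs are finite, simple and undirected. The competition graph $C(D)$ of a digraph $D$ is the graph with vertex set $V(D)$ in which distinct $x,y$ are adjacent iff there is a vertex $v$ with $(x,v),(y,v)$ both arcs of $D$. The competition number $k(G)$ of a graph $G$ is the minimum integer $k\ge 0$ such that $G$ together with $k$ new isolated vertices is the competition graph of an acyclic digraph. An edge clique cover of $G$ is a family of cliques (vertex sets inducing complete subgraphs) such that each edge has both endpoints in some clique of the family; $\theta_E(G)$ is the minimum size of an edge clique cover. A graph $G$ is called competitively tight if $k(G)=\theta_E(G)-|V(G)|+2$. -}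

module Defs where

open import Data.Nat using (ℕ; zero; suc; _+_; _≤_; _<ᵇ_)
open import Data.Fin using (Fin; toℕ; splitAt)
open import Data.Bool using (Bool; true; false; _∧_; if_then_else_)
open import Data.List using (List; map; allFin)
open import Data.Nat.ListAction using (sum)
open import Data.Empty using (⊥)
open import Data.Sum using (_⊎_; inj₁; inj₂)
open import Data.Product using (Σ; ∃; ∃-syntax; _×_; _,_)
open import Relation.Nullary using (¬_)
open import Relation.Binary.PropositionalEquality using (_≡_; _≢_)
open import Relation.Binary.Construct.Closure.Transitive using (TransClosure)
open import Data.Integer as ℤ using (ℤ; +_)

record Graph : Set where
  field
    n      : ℕ
    adj    : Fin n → Fin n → Bool
    sym    : ∀ x y → adj x y ≡ adj y x
    irrefl : ∀ x → adj x x ≡ false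
open Graph public

∣V∣ : Graph → ℕ
∣V∣ G = n G

∣E∣ : Graph → ℕ
∣E∣ G = sum (map (λ i → sum (map (λ j →
          if (toℕ i <ᵇ toℕ j) ∧ adj G i j then 1 else 0) (allFin (n G)))) (allFin (n G)))

TriangleFree : Graph → Set
TriangleFree G = ∀ x y z → adj G x y ≡ true → adj G y z ≡ true → adj G x z ≡ true → ⊥

IsolatedVertex : (G : Graph) → Fin (n G) → Set
IsolatedVertex G x = ∀ y → adj G x y ≡ false

HasIsolatedVertex : Graph → Set
HasIsolatedVertex G = ∃[ x ] IsolatedVertex G x

-- Adjacency of G together with k new isolated vertices (vertices n,…,n+k-1).
adjPlus : (G : Graph) (k : ℕ) → Fin (n G + k) → Fin (n G + k) → Bool
adjPlus G k x y with splitAt (n G) x | splitAt (n G) y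
... | inj₁ x' | inj₁ y' = adj G x' y'
... | _       | _       = false

Acyclic : {m : ℕ} → (Fin m → Fin m → Bool) → Set
Acyclic {m} D = ∀ v → ¬ TransClosure (λ x y → D x y ≡ true) v v

IsCompetitionGraphOf : {m : ℕ} → (Fin m → Fin m → Bool) → (Fin m → Fin m → Bool) → Set
IsCompetitionGraphOf {m} A D =
  ∀ x y → x ≢ y →
    (A x y ≡ true → ∃[ v ] (D x v ≡ true × D y v ≡ true)) ×
    (∃[ v ] (D x v ≡ true × D y v ≡ true) → A x y ≡ true)

CompRealizable : Graph → ℕ → Set
CompRealizable G k =
  ∃[ D ] (Acyclic D × IsCompetitionGraphOf (adjPlus G k) D)

IsCompetitionNumber : Graph → ℕ → Set
IsCompetitionNumber G k =
  CompRealizable G k × (∀ k' → CompRealizable G k' → k ≤ k')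

IsClique : (G : Graph) → (Fin (n G) → Bool) → Set
IsClique G S = ∀ x y → x ≢ y → S x ≡ true → S y ≡ true → adj G x y ≡ true

IsEdgeCliqueCover : (G : Graph) (t : ℕ) → (Fin t → Fin (n G) → Bool) → Set
IsEdgeCliqueCover G t F =
  (∀ i → IsClique G (F i)) ×
  (∀ x y → adj G x y ≡ true → ∃[ i ] (F i x ≡ true × F i y ≡ true))

HasEdgeCliqueCoverOfSize : Graph → ℕ → Set
HasEdgeCliqueCoverOfSize G t = ∃[ F ] IsEdgeCliqueCover G t F

IsEdgeCliqueCoverNumber : Graph → ℕ → Set
IsEdgeCliqueCoverNumber G t =
  HasEdgeCliqueCoverOfSize G t × (∀ t' → HasEdgeCliqueCoverOfSize G t' → t ≤ t')

CompetitivelyTight : Graph → Set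
CompetitivelyTight G =
  ∃[ k ] ∃[ t ] (IsCompetitionNumber G k × IsEdgeCliqueCoverNumber G t ×
                 (+ k ≡ (+ t ℤ.- + ∣V∣ G) ℤ.+ + 2))

-- Let G be triangle-free with n vertices and e edges.  The proof computes
-- θ_E(G) and, under the stated conditions, k(G):
--  * θ_E(G) = e: a clique of a triangle-free graph spans at most one edge,
--    and the edges themselves form a cover (Bounds.edgeCover, cover-size).
--  * k(G) ≥ e - n + 2 if n ≥ 2 (Opsut's bound, Bounds.k-lowerBound): the
--    in-neighbourhoods of a digraph D with C(D) = G ∪ I_k are cliques covering
--    E(G), and those of two suitable sources of D span no edge.
--  * k(G) ≤ e - n + 2 if G has an elimination order, i.e. a numbering of the
--    vertices and of the edges in which edge i joins vertices numbered ≤ i + 1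
--    (Realization): edge i gets its own prey at position i + 2.  Such an order
--    exists if n ≤ e + 1, by repeatedly deleting a vertex of minimum degree
--    (degree averaging preserves the inequality), and if n ≤ e + 2 when G has
--    an isolated vertex, which is then deleted first (Elimination).
--  * k(G) = 0 if n ≤ 1, and k(G) ≥ 1 if G has no isolated vertex, since a
--    sink of D would be a vertex of G without prey (Bounds).
-- Tightness says k(G) + n = e + 2, and the theorem follows from these facts.

module Submission where

open import Defs renaming (sym to adj-sym; irrefl to adj-irrefl)
open import Data.Nat using (ℕ; zero; suc; _+_; _*_; _∸_; _≤_; _<_; z≤n; s≤s; _≤?_; _<?_; _<ᵇ_)
open import Data.Nat.Properties
open import Algebra.Properties.Semiring.Sum +-*-semiring
  using (sum; sum-cong-≗; sum-replicate-zero; ∑-distrib-+; ∑-comm; *-distribʳ-sum)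
open import Data.Fin as Fin using (Fin; toℕ; splitAt; _↑ˡ_; _↑ʳ_; fromℕ<)
open import Data.Fin.Properties
  using (toℕ-injective; toℕ<n; toℕ-fromℕ<; fromℕ<-toℕ; toℕ-↑ˡ; toℕ-↑ʳ;
         splitAt-↑ˡ; splitAt-↑ʳ; splitAt⁻¹-↑ˡ; splitAt⁻¹-↑ʳ; ↑ˡ-injective; pigeonhole; ¬∀⟶∃¬; any?; all?)
  renaming (suc-injective to fsuc-injective)
open import Data.Bool using (Bool; true; false; _∧_; _∨_; not; if_then_else_)
open import Data.Bool.Properties using (∧-zeroʳ; ∧-identityʳ; ∨-zeroʳ; T-≡; ¬-not) renaming (_≟_ to _≟ᵇ_)
open import Data.Nat.Solver using (module +-*-Solver)
import Data.Nat.ListAction as ListAction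
import Data.List as List
open import Data.List.Properties using (map-tabulate)
import Data.Integer as ℤ
import Data.Integer.Properties as ℤ
open import Data.Integer.Solver using () renaming (module +-*-Solver to ℤSolver)
open import Data.Empty using (⊥; ⊥-elim)
open import Data.Sum using (_⊎_; inj₁; inj₂; [_,_])
open import Data.Product using (∃; _×_; _,_; proj₁; proj₂)
open import Function using (_∘_; id)
open import Function.Bundles using (_⇔_; mk⇔; Equivalence)
open import Relation.Binary.Construct.Closure.Transitive using (TransClosure; _∷_; _∷ʳ_) renaming ([_] to [_]⁺)
open import Relation.Nullary using (¬_; yes; no; Dec; does)
open import Relation.Nullary.Decidable using (dec-true; dec-false; _×-dec_; _→-dec_)
open import Relation.Binary.Definitions using (tri<; tri≈; tri>)
open import Relation.Binary.PropositionalEquality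
  using (_≡_; _≢_; refl; sym; trans; cong; cong₂; subst; subst₂; module ≡-Reasoning)

sum-mono : ∀ {m} {f g : Fin m → ℕ} → (∀ i → f i ≤ g i) → sum f ≤ sum g
sum-mono {zero}  _ = z≤n
sum-mono {suc m} h = +-mono-≤ (h Fin.zero) (sum-mono (h ∘ Fin.suc))

term≤sum : ∀ {m} (f : Fin m → ℕ) i → f i ≤ sum f
term≤sum f Fin.zero    = m≤m+n _ _
term≤sum f (Fin.suc i) = ≤-trans (term≤sum (f ∘ Fin.suc) i) (m≤n+m _ _)

sum-zero : ∀ {m} (f : Fin m → ℕ) → (∀ i → f i ≡ 0) → sum f ≡ 0
sum-zero {m} f h = trans (sum-cong-≗ h) (sum-replicate-zero m)

sum-pos : ∀ {m} (f : Fin m → ℕ) → 1 ≤ sum f → ∃ λ i → 1 ≤ f i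
sum-pos {suc m} f h with f Fin.zero in eq
... | suc _ = Fin.zero , subst (1 ≤_) (sym eq) (s≤s z≤n)
... | zero with sum-pos (f ∘ Fin.suc) h
...   | i , p = Fin.suc i , p

sum-only : ∀ {m} (f : Fin m → ℕ) v → (∀ w → w ≢ v → f w ≡ 0) → sum f ≡ f v
sum-only {suc m} f Fin.zero h =
  trans (cong (f Fin.zero +_) (sum-zero _ (λ i → h (Fin.suc i) (λ ())))) (+-identityʳ _)
sum-only {suc m} f (Fin.suc v) h =
  trans (cong (_+ sum (f ∘ Fin.suc)) (h Fin.zero (λ ())))
        (sum-only (f ∘ Fin.suc) v (λ w w≢v → h (Fin.suc w) (w≢v ∘ fsuc-injective)))

sum-atMostOne : ∀ {m} (f : Fin m → ℕ) → (∀ i → f i ≤ 1) →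
                (∀ i j → 1 ≤ f i → 1 ≤ f j → i ≡ j) → sum f ≤ 1
sum-atMostOne {zero}  f _ _ = z≤n
sum-atMostOne {suc m} f ≤1 unique with f Fin.zero in eq
... | zero = sum-atMostOne (f ∘ Fin.suc) (≤1 ∘ Fin.suc)
               (λ i j p q → fsuc-injective (unique (Fin.suc i) (Fin.suc j) p q))
... | suc x = begin
  suc x + sum (f ∘ Fin.suc)  ≡⟨ cong (suc x +_) (sum-zero _ rest-zero) ⟩
  suc x + 0                  ≡⟨ +-identityʳ _ ⟩
  suc x                      ≡⟨ sym eq ⟩
  f Fin.zero                 ≤⟨ ≤1 Fin.zero ⟩
  1                          ∎
  where
  open ≤-Reasoning
  rest-zero : ∀ i → f (Fin.suc i) ≡ 0
  rest-zero i with f (Fin.suc i) in eq′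
  ... | zero  = refl
  ... | suc _ with unique Fin.zero (Fin.suc i) (subst (1 ≤_) (sym eq) (s≤s z≤n))
                                             (subst (1 ≤_) (sym eq′) (s≤s z≤n))
  ...   | ()

sum-bound : ∀ {m} (f : Fin m → ℕ) → (∀ i → f i ≤ 1) → sum f ≤ m
sum-bound {zero}  f _  = z≤n
sum-bound {suc m} f ≤1 = +-mono-≤ (≤1 Fin.zero) (sum-bound (f ∘ Fin.suc) (≤1 ∘ Fin.suc))

sum-oneZero : ∀ {m} (f : Fin m → ℕ) → (∀ i → f i ≤ 1) → ∀ s → f s ≡ 0 → suc (sum f) ≤ m
sum-oneZero f ≤1 Fin.zero f0 rewrite f0 = s≤s (sum-bound (f ∘ Fin.suc) (≤1 ∘ Fin.suc))
sum-oneZero f ≤1 (Fin.suc s) fs =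
  ≤-trans (s≤s (+-monoˡ-≤ _ (≤1 Fin.zero))) (s≤s (sum-oneZero (f ∘ Fin.suc) (≤1 ∘ Fin.suc) s fs))

sum-twoZeros : ∀ {m} (f : Fin m → ℕ) → (∀ i → f i ≤ 1) →
               ∀ s t → s ≢ t → f s ≡ 0 → f t ≡ 0 → suc (suc (sum f)) ≤ m
sum-twoZeros f ≤1 Fin.zero Fin.zero s≢t _ _ = ⊥-elim (s≢t refl)
sum-twoZeros f ≤1 Fin.zero (Fin.suc t) _ fs ft rewrite fs =
  s≤s (sum-oneZero (f ∘ Fin.suc) (≤1 ∘ Fin.suc) t ft)
sum-twoZeros f ≤1 (Fin.suc s) Fin.zero _ fs ft rewrite ft =
  s≤s (sum-oneZero (f ∘ Fin.suc) (≤1 ∘ Fin.suc) s fs)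
sum-twoZeros f ≤1 (Fin.suc s) (Fin.suc t) s≢t fs ft =
  ≤-trans (s≤s (s≤s (+-monoˡ-≤ _ (≤1 Fin.zero))))
          (s≤s (sum-twoZeros (f ∘ Fin.suc) (≤1 ∘ Fin.suc) s t (s≢t ∘ cong Fin.suc) fs ft))

listSum-allFin : ∀ {m} (f : Fin m → ℕ) → ListAction.sum (List.map f (List.allFin m)) ≡ sum f
listSum-allFin f = trans (cong ListAction.sum (map-tabulate id f)) (listSum-tabulate f)
  where
  listSum-tabulate : ∀ {m} (f : Fin m → ℕ) → ListAction.sum (List.tabulate f) ≡ sum f
  listSum-tabulate {zero}  f = refl
  listSum-tabulate {suc m} f = cong (f Fin.zero +_) (listSum-tabulate (f ∘ Fin.suc))

ind : Bool → ℕ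
ind b = if b then 1 else 0

ind≤1 : ∀ b → ind b ≤ 1
ind≤1 true  = s≤s z≤n
ind≤1 false = z≤n

ind-pos : ∀ {b} → 1 ≤ ind b → b ≡ true
ind-pos {true} _ = refl

∧-intro : ∀ {x y} → x ≡ true → y ≡ true → x ∧ y ≡ true
∧-intro refl refl = refl

∧-elim : ∀ {x y} → x ∧ y ≡ true → x ≡ true × y ≡ true
∧-elim {true} {true} _ = refl , refl

false≢true : false ≢ true
false≢true ()

count : ∀ {m} → (Fin m → Bool) → ℕ
count P = sum (ind ∘ P)

enum : ∀ {m} (P : Fin m → Bool) → Fin (count P) → Fin m
enum {suc m} P j with P Fin.zero
enum {suc m} P Fin.zero    | true  = Fin.zero
enum {suc m} P (Fin.suc j) | true  = Fin.suc (enum (P ∘ Fin.suc) j)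
enum {suc m} P j           | false = Fin.suc (enum (P ∘ Fin.suc) j)

enum-sound : ∀ {m} (P : Fin m → Bool) j → P (enum P j) ≡ true
enum-sound {suc m} P j with P Fin.zero in eq
enum-sound {suc m} P Fin.zero    | true  = eq
enum-sound {suc m} P (Fin.suc j) | true  = enum-sound (P ∘ Fin.suc) j
enum-sound {suc m} P j           | false = enum-sound (P ∘ Fin.suc) j

enum-complete : ∀ {m} (P : Fin m → Bool) a → P a ≡ true → ∃ λ j → enum P j ≡ a
enum-complete {suc m} P a Pa with P Fin.zero in eq
enum-complete {suc m} P Fin.zero    Pa | true = Fin.zero , refl
enum-complete {suc m} P Fin.zero    Pa | false = ⊥-elim (false≢true (trans (sym eq) Pa))
enum-complete {suc m} P (Fin.suc a) Pa | b with enum-complete (P ∘ Fin.suc) a Pa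
enum-complete {suc m} P (Fin.suc a) Pa | true  | j , e = Fin.suc j , cong Fin.suc e
enum-complete {suc m} P (Fin.suc a) Pa | false | j , e = j , cong Fin.suc e

_==_ : ∀ {m} → Fin m → Fin m → Bool
a == b = does (a Fin.≟ b)

==-refl : ∀ {m} (a : Fin m) → (a == a) ≡ true
==-refl a = dec-true (a Fin.≟ a) refl

==-≢ : ∀ {m} {a b : Fin m} → a ≢ b → (a == b) ≡ false
==-≢ {a = a} {b} = dec-false (a Fin.≟ b)

==-sound : ∀ {m} (a b : Fin m) → (a == b) ≡ true → a ≡ b
==-sound a b eq with a Fin.≟ b
... | yes a≡b = a≡b

==-elim : ∀ {m} (P : Fin m → Set) a b → P b → (a == b) ≡ true → P a
==-elim P a b Pb a==b = subst P (sym (==-sound a b a==b)) Pb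

_≺_ : ∀ {m} → Fin m → Fin m → Bool
a ≺ b = toℕ a <ᵇ toℕ b

≺-sound : ∀ {m} (a b : Fin m) → (a ≺ b) ≡ true → toℕ a < toℕ b
≺-sound a b eq = <ᵇ⇒< (toℕ a) (toℕ b) (Equivalence.from T-≡ eq)

≺-complete : ∀ {m} {a b : Fin m} → toℕ a < toℕ b → (a ≺ b) ≡ true
≺-complete a<b = Equivalence.to T-≡ (<⇒<ᵇ a<b)

≺-false : ∀ {m} (a b : Fin m) → ¬ (toℕ a < toℕ b) → (a ≺ b) ≡ false
≺-false a b a≮b with a ≺ b in eq
... | true  = ⊥-elim (a≮b (≺-sound a b eq))
... | false = refl

≺-irrefl : ∀ {m} (a : Fin m) → (a ≺ a) ≡ false
≺-irrefl a = ≺-false a a (<-irrefl refl)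

≺-asym : ∀ {m} (a b : Fin m) → (a ≺ b) ≡ true → (b ≺ a) ≡ false
≺-asym a b a≺b = ≺-false b a (<-asym (≺-sound a b a≺b))

≺⇒≢ : ∀ {m} (a b : Fin m) → (a ≺ b) ≡ true → a ≢ b
≺⇒≢ a .a a≺a refl = false≢true (trans (sym (≺-irrefl a)) a≺a)

≺-connex : ∀ {m} {a b : Fin m} → a ≢ b → (a ≺ b) ≡ true ⊎ (b ≺ a) ≡ true
≺-connex {a = a} {b} a≢b with <-cmp (toℕ a) (toℕ b)
... | tri< a<b _ _ = inj₁ (≺-complete a<b)
... | tri≈ _ a≡b _ = ⊥-elim (a≢b (toℕ-injective a≡b))
... | tri> _ _ b<a = inj₂ (≺-complete b<a)

≺-both-false : ∀ {m} (a b : Fin m) → (a ≺ b) ≡ false → (b ≺ a) ≡ false → a ≡ b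
≺-both-false a b a⊀b b⊀a with a Fin.≟ b
... | yes a≡b = a≡b
... | no  a≢b with ≺-connex a≢b
...   | inj₁ a≺b = ⊥-elim (false≢true (trans (sym a⊀b) a≺b))
...   | inj₂ b≺a = ⊥-elim (false≢true (trans (sym b⊀a) b≺a))

toℕ-splitAt-inj₁ : ∀ m {k} {i : Fin (m + k)} {j} → splitAt m i ≡ inj₁ j → toℕ i ≡ toℕ j
toℕ-splitAt-inj₁ m {k} {j = j} split = trans (cong toℕ (sym (splitAt⁻¹-↑ˡ split))) (toℕ-↑ˡ j k)

toℕ-splitAt-inj₂ : ∀ m {k} {i : Fin (m + k)} {j} → splitAt m i ≡ inj₂ j → toℕ i ≡ m + toℕ j
toℕ-splitAt-inj₂ m {j = j} split = trans (cong toℕ (sym (splitAt⁻¹-↑ʳ split))) (toℕ-↑ʳ m j)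

argmin : ∀ {m} (P : Fin m → Bool) (w : Fin m → ℕ) →
         (∃ λ v → P v ≡ true × ∀ u → P u ≡ true → w v ≤ w u) ⊎ (∀ u → P u ≡ false)
argmin {zero}  P w = inj₂ (λ ())
argmin {suc m} P w with argmin (P ∘ Fin.suc) (w ∘ Fin.suc) | P Fin.zero in P0
... | inj₂ none | false = inj₂ λ { Fin.zero → P0 ; (Fin.suc u) → none u }
... | inj₂ none | true  = inj₁ (Fin.zero , P0 , λ
        { Fin.zero _ → ≤-refl ; (Fin.suc u) Pu → ⊥-elim (false≢true (trans (sym (none u)) Pu)) })
... | inj₁ (v , Pv , min) | false = inj₁ (Fin.suc v , Pv , λ
        { Fin.zero Pu → ⊥-elim (false≢true (trans (sym P0) Pu)) ; (Fin.suc u) Pu → min u Pu })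
... | inj₁ (v , Pv , min) | true with w Fin.zero ≤? w (Fin.suc v)
...   | yes w0≤ = inj₁ (Fin.zero , P0 , λ
          { Fin.zero _ → ≤-refl ; (Fin.suc u) Pu → ≤-trans w0≤ (min u Pu) })
...   | no  w0≰ = inj₁ (Fin.suc v , Pv , λ
          { Fin.zero _ → <⇒≤ (≰⇒> w0≰) ; (Fin.suc u) Pu → min u Pu })

ind-remove : ∀ s e → (e ≡ true → s ≡ true) → ind s ≡ ind (s ∧ not e) + ind e
ind-remove true  true  _ = refl
ind-remove true  false _ = refl
ind-remove false false _ = refl
ind-remove false true  e⇒s with e⇒s refl
... | ()

-- A pair (a , b) with a ≺ b and a, b ∈ S either avoids v, or has a = v, or b = v.
ind-removePair : ∀ l sa sb x ea eb → (ea ≡ true → sa ≡ true) → (eb ≡ true → sb ≡ true) →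
  (ea ≡ true → eb ≡ true → l ≡ false) →
  ind (l ∧ (sa ∧ (sb ∧ x))) ≡
    ind (l ∧ ((sa ∧ not ea) ∧ ((sb ∧ not eb) ∧ x))) + ind (ea ∧ (l ∧ ((sb ∧ not eb) ∧ x)))
      + ind (eb ∧ (l ∧ ((sa ∧ not ea) ∧ x)))
ind-removePair l sa sb x false false _ _ _
  rewrite ∧-identityʳ sa | ∧-identityʳ sb | +-identityʳ (ind (l ∧ (sa ∧ (sb ∧ x)))) =
  sym (+-identityʳ _)
ind-removePair false sa sb x true false _ _ _ = refl
ind-removePair true sa sb x true false sa≡ _ _
  rewrite sa≡ refl | ∧-identityʳ sb | +-identityʳ (ind (sb ∧ x)) = refl
ind-removePair false sa sb x false true _ _ _ = refl
ind-removePair true true sb x false true _ sb≡ _ rewrite sb≡ refl = refl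
ind-removePair true false sb x false true _ _ _ = refl
ind-removePair l sa sb x true true _ _ l≡ rewrite l≡ refl refl = refl

-- A symmetric condition c on a pair holds in exactly one orientation l₁ or l₂.
ind-orient : ∀ l₁ l₂ c c′ → c′ ≡ c → (l₁ ≡ true → l₂ ≡ false) →
             (l₁ ≡ false → l₂ ≡ false → c ≡ false) → ind c ≡ ind (l₁ ∧ c) + ind (l₂ ∧ c′)
ind-orient true  l₂    c .c refl l₁⇒ _ rewrite l₁⇒ refl = sym (+-identityʳ _)
ind-orient false true  c .c refl _   _ = refl
ind-orient false false c .c refl _   c≡ rewrite c≡ refl refl = refl

ind-removeIrrelevant : ∀ s e x → (e ≡ true → x ≡ false) → ind ((s ∧ not e) ∧ x) ≡ ind (s ∧ x)
ind-removeIrrelevant s false x _ rewrite ∧-identityʳ s = refl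
ind-removeIrrelevant s true  x x≡ rewrite x≡ refl | ∧-zeroʳ s = refl

∧-swap : ∀ a b c → a ∧ (b ∧ c) ≡ b ∧ (a ∧ c)
∧-swap true  b c = refl
∧-swap false b c = sym (∧-zeroʳ b)

ind-scale : ∀ {m} s (g : Fin m → Bool) → sum (λ b → ind (s ∧ g b)) ≡ ind s * count g
ind-scale     true  g = sym (+-identityʳ _)
ind-scale {m} false g = sum-zero {m} _ (λ _ → refl)

sum-row : ∀ {m k} v (h : Fin m → Fin k → Bool) →
          sum (λ a → sum (λ b → ind ((a == v) ∧ h a b))) ≡ sum (λ b → ind (h v b))
sum-row v h =
  trans (sum-only _ v (λ w w≢v → sum-zero _ (λ b → cong (λ e → ind (e ∧ h w b)) (==-≢ w≢v))))
        (sum-cong-≗ (λ b → cong (λ e → ind (e ∧ h v b)) (==-refl v)))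

module Induced (G : Graph) where

  N : ℕ
  N = n G

  A : Fin N → Fin N → Bool
  A = adj G

  VSet : Set
  VSet = Fin N → Bool

  full : VSet
  full _ = true

  size : VSet → ℕ
  size = count

  edges : VSet → ℕ
  edges S = sum (λ a → sum (λ b → ind (a ≺ b ∧ (S a ∧ (S b ∧ A a b)))))

  -- The degree of v in G[S ∪ {v}].
  deg : VSet → Fin N → ℕ
  deg S v = count (λ b → S b ∧ A v b)

  _─_ : VSet → Fin N → VSet
  (S ─ v) w = S w ∧ not (w == v)

  ─-self : ∀ S v → (S ─ v) v ≡ false
  ─-self S v rewrite ==-refl v = ∧-zeroʳ (S v)

  ─-other : ∀ S v w → w ≢ v → (S ─ v) w ≡ S w
  ─-other S v w w≢v rewrite ==-≢ w≢v = ∧-identityʳ (S w)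

  ─-⊆ : ∀ S v w → (S ─ v) w ≡ true → S w ≡ true
  ─-⊆ S v w = proj₁ ∘ ∧-elim

  ─-≢ : ∀ S v w → (S ─ v) w ≡ true → w ≢ v
  ─-≢ S v w S─v∋w refl = false≢true (trans (sym (─-self S v)) S─v∋w)

  size-─ : ∀ S v → S v ≡ true → size S ≡ suc (size (S ─ v))
  size-─ S v Sv = begin
      size S
    ≡⟨ sum-cong-≗ (λ w → ind-remove (S w) (w == v) (==-elim (λ u → S u ≡ true) w v Sv)) ⟩
      sum (λ w → ind ((S ─ v) w) + ind (w == v))
    ≡⟨ ∑-distrib-+ (ind ∘ (S ─ v)) (λ w → ind (w == v)) ⟩
      size (S ─ v) + sum (λ w → ind (w == v))
    ≡⟨ cong (size (S ─ v) +_) (trans (sum-only _ v (λ w w≢v → cong ind (==-≢ w≢v)))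
                                      (cong ind (==-refl v))) ⟩
      size (S ─ v) + 1
    ≡⟨ +-comm _ 1 ⟩
      suc (size (S ─ v)) ∎
    where open ≡-Reasoning

  deg-─ : ∀ S v → deg (S ─ v) v ≡ deg S v
  deg-─ S v = sum-cong-≗ (λ b → ind-removeIrrelevant (S b) (b == v) (A v b)
    (==-elim (λ u → A v u ≡ false) b v (adj-irrefl G v)))

  deg-orient : ∀ S v → S v ≡ false →
    deg S v ≡ sum (λ b → ind (v ≺ b ∧ (S b ∧ A v b))) + sum (λ a → ind (a ≺ v ∧ (S a ∧ A a v)))
  deg-orient S v Sv = trans
    (sum-cong-≗ (λ b → ind-orient (v ≺ b) (b ≺ v) (S b ∧ A v b) (S b ∧ A b v)
       (cong (S b ∧_) (adj-sym G b v)) (≺-asym v b)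
       (λ v⊀b b⊀v → subst (λ u → S u ∧ A v u ≡ false) (≺-both-false v b v⊀b b⊀v) (cong (_∧ A v v) Sv))))
    (∑-distrib-+ (λ b → ind (v ≺ b ∧ (S b ∧ A v b))) (λ b → ind (b ≺ v ∧ (S b ∧ A b v))))

  edges-─ : ∀ S v → S v ≡ true → edges S ≡ edges (S ─ v) + deg (S ─ v) v
  edges-─ S v Sv = begin
      edges S
    ≡⟨ sum-cong-≗ (λ a → sum-cong-≗ (λ b → ind-removePair (a ≺ b) (S a) (S b) (A a b) (a == v) (b == v)
          (==-elim (λ u → S u ≡ true) a v Sv) (==-elim (λ u → S u ≡ true) b v Sv)
          (λ a==v b==v → ==-elim (λ u → u ≺ b ≡ false) a v
                            (==-elim (λ u → v ≺ u ≡ false) b v (≺-irrefl v) b==v) a==v))) ⟩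
      sum (λ a → sum (λ b → inner a b + row a b + column a b))
    ≡⟨ sum-cong-≗ (λ a → trans (∑-distrib-+ (λ b → inner a b + row a b) (column a))
                                (cong (_+ sum (column a)) (∑-distrib-+ (inner a) (row a)))) ⟩
      sum (λ a → sum (inner a) + sum (row a) + sum (column a))
    ≡⟨ trans (∑-distrib-+ (λ a → sum (inner a) + sum (row a)) (λ a → sum (column a)))
             (cong (_+ sum (λ a → sum (column a))) (∑-distrib-+ (λ a → sum (inner a)) (λ a → sum (row a)))) ⟩
      edges S′ + sum (λ a → sum (row a)) + sum (λ a → sum (column a))
    ≡⟨ +-assoc (edges S′) _ _ ⟩
      edges S′ + (sum (λ a → sum (row a)) + sum (λ a → sum (column a)))
    ≡⟨ cong (edges S′ +_) (cong₂ _+_ (sum-row v (λ a b → a ≺ b ∧ (S′ b ∧ A a b)))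
                                      (trans (∑-comm column) (sum-row v (λ b a → a ≺ b ∧ (S′ a ∧ A a b))))) ⟩
      edges S′ + (sum (λ b → ind (v ≺ b ∧ (S′ b ∧ A v b))) + sum (λ a → ind (a ≺ v ∧ (S′ a ∧ A a v))))
    ≡⟨ cong (edges S′ +_) (sym (deg-orient S′ v (─-self S v))) ⟩
      edges S′ + deg S′ v ∎
    where
    open ≡-Reasoning
    S′ = S ─ v
    inner row column : Fin N → Fin N → ℕ
    inner  a b = ind (a ≺ b ∧ (S′ a ∧ (S′ b ∧ A a b)))
    row    a b = ind ((a == v) ∧ (a ≺ b ∧ (S′ b ∧ A a b)))
    column a b = ind ((b == v) ∧ (a ≺ b ∧ (S′ a ∧ A a b)))

  handshake : ∀ S → sum (λ v → ind (S v) * deg S v) ≡ edges S + edges S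
  handshake S = begin
      sum (λ v → ind (S v) * deg S v)
    ≡⟨ sum-cong-≗ (λ v → sym (ind-scale (S v) (λ b → S b ∧ A v b))) ⟩
      sum (λ v → sum (λ b → ind (S v ∧ (S b ∧ A v b))))
    ≡⟨ sum-cong-≗ (λ v → trans (sum-cong-≗ (orient v)) (∑-distrib-+ (forward v) (backward v))) ⟩
      sum (λ v → sum (forward v) + sum (backward v))
    ≡⟨ ∑-distrib-+ (λ v → sum (forward v)) (λ v → sum (backward v)) ⟩
      edges S + sum (λ v → sum (backward v))
    ≡⟨ cong (edges S +_) (∑-comm backward) ⟩
      edges S + edges S ∎
    where
    open ≡-Reasoning
    ∧-zeroʳ-twice : ∀ s → s ∧ (s ∧ false) ≡ false
    ∧-zeroʳ-twice s rewrite ∧-zeroʳ s = ∧-zeroʳ s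
    forward backward : Fin N → Fin N → ℕ
    forward  v b = ind (v ≺ b ∧ (S v ∧ (S b ∧ A v b)))
    backward v b = ind (b ≺ v ∧ (S b ∧ (S v ∧ A b v)))
    orient : ∀ v b → ind (S v ∧ (S b ∧ A v b)) ≡ forward v b + backward v b
    orient v b = ind-orient (v ≺ b) (b ≺ v) _ _
      (trans (∧-swap (S b) (S v) (A b v)) (cong (λ x → S v ∧ (S b ∧ x)) (adj-sym G b v))) (≺-asym v b)
      (λ v⊀b b⊀v → subst (λ u → S v ∧ (S u ∧ A v u) ≡ false) (≺-both-false v b v⊀b b⊀v)
                          (trans (cong (λ x → S v ∧ (S v ∧ x)) (adj-irrefl G v)) (∧-zeroʳ-twice (S v))))

  size-full : size full ≡ N
  size-full = count-true N
    where
    count-true : ∀ m → count {m} (λ _ → true) ≡ m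
    count-true zero    = refl
    count-true (suc m) = cong suc (count-true m)

  ∣E∣≡edges : ∣E∣ G ≡ edges full
  ∣E∣≡edges = trans (listSum-allFin (λ a → ListAction.sum (List.map (row a) (List.allFin N))))
                    (sum-cong-≗ (λ a → listSum-allFin (row a)))
    where
    row : Fin N → Fin N → ℕ
    row a b = ind (a ≺ b ∧ A a b)

-- Degree averaging.  Let a graph have s vertices, e + δ edges and minimum
-- degree δ, so that s·δ ≤ 2(e + δ).  If s ≤ (e + δ) + 1, then after deleting
-- a vertex of degree δ still s - 1 ≤ e + 1.
minDegree-deletion : ∀ s e δ → s ≤ suc (e + δ) → s * δ ≤ (e + δ) + (e + δ) → s ≤ 2 + e
minDegree-deletion s e zero       s≤ _ = ≤-trans s≤ (s≤s (≤-trans (≤-reflexive (+-identityʳ e)) (n≤1+n e)))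
minDegree-deletion s e (suc zero) s≤ _ = ≤-trans s≤ (s≤s (≤-reflexive (+-comm e 1)))
minDegree-deletion s e δ@(suc (suc d)) _ sδ≤ with s ≤? 2 + e
... | yes s≤2+e = s≤2+e
... | no  s≰2+e = ⊥-elim (m+n≮m twice (e * d + suc d) (begin-strict
    twice + (e * d + suc d)        <⟨ n<1+n _ ⟩
    suc (twice + (e * d + suc d))  ≡⟨ expand ⟩
    (3 + e) * δ                    ≤⟨ *-monoˡ-≤ δ (≰⇒> s≰2+e) ⟩
    s * δ                          ≤⟨ sδ≤ ⟩
    twice                          ∎))
  where
  open ≤-Reasoning
  open +-*-Solver
  twice : ℕ
  twice = (e + δ) + (e + δ)
  expand : suc (twice + (e * d + suc d)) ≡ (3 + e) * δ
  expand = solve 2 (λ e d → con 1 :+ (((e :+ (con 2 :+ d)) :+ (e :+ (con 2 :+ d))) :+ (e :* d :+ (con 1 :+ d)))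
                            := (con 3 :+ e) :* (con 2 :+ d)) refl e d

_∈ₑ_ : ∀ {m} → Fin m → Fin m × Fin m → Set
x ∈ₑ (a , b) = x ≡ a ⊎ x ≡ b

pair-endpoints : ∀ {m} {e : Fin m × Fin m} {a b} → e ≡ (a , b) → a ∈ₑ e × b ∈ₑ e
pair-endpoints refl = inj₁ refl , inj₂ refl

_∈ₑ?_ : ∀ {m} → Fin m → Fin m × Fin m → Bool
x ∈ₑ? (a , b) = (x == a) ∨ (x == b)

∈ₑ?-sound : ∀ {m} (x : Fin m) e → (x ∈ₑ? e) ≡ true → x ∈ₑ e
∈ₑ?-sound x (a , b) x∈ with x == a in x==a
... | true  = inj₁ (==-sound x a x==a)
... | false = inj₂ (==-sound x b x∈)

∈ₑ?-complete : ∀ {m} (x : Fin m) e → x ∈ₑ e → (x ∈ₑ? e) ≡ true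
∈ₑ?-complete x (.x , b) (inj₁ refl) rewrite ==-refl x = refl
∈ₑ?-complete x (a , .x) (inj₂ refl) rewrite ==-refl x = ∨-zeroʳ (x == a)

module Elimination (G : Graph) where
  open Induced G

  record EdgeList (S : VSet) : Set where
    field
      len      : ℕ
      len≡     : len ≡ edges S
      edge     : Fin len → Fin N × Fin N
      edge-in  : ∀ i → S (proj₁ (edge i)) ≡ true × S (proj₂ (edge i)) ≡ true ×
                       A (proj₁ (edge i)) (proj₂ (edge i)) ≡ true
      complete : ∀ a b → S a ≡ true → S b ≡ true → A a b ≡ true →
                 ∃ λ i → a ∈ₑ edge i × b ∈ₑ edge i

  endpoints-adjacent : ∀ {S} (L : EdgeList S) i x y → x ∈ₑ EdgeList.edge L i → y ∈ₑ EdgeList.edge L i →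
                       x ≢ y → A x y ≡ true
  endpoints-adjacent L i x y (inj₁ refl) (inj₁ refl) x≢y = ⊥-elim (x≢y refl)
  endpoints-adjacent L i x y (inj₁ refl) (inj₂ refl) _   = proj₂ (proj₂ (EdgeList.edge-in L i))
  endpoints-adjacent L i x y (inj₂ refl) (inj₁ refl) _   =
    trans (adj-sym G _ _) (proj₂ (proj₂ (EdgeList.edge-in L i)))
  endpoints-adjacent L i x y (inj₂ refl) (inj₂ refl) x≢y = ⊥-elim (x≢y refl)

  size≡0 : ∀ S → size S ≡ 0 → ∀ v → S v ≡ false
  size≡0 S |S|≡0 v with S v | term≤sum (ind ∘ S) v
  ... | false | _ = refl
  ... | true  | 1≤|S| with subst (1 ≤_) |S|≡0 1≤|S|
  ...   | ()

  noEdges : ∀ S → size S ≡ 0 → EdgeList S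
  noEdges S |S|≡0 = record
    { len      = 0
    ; len≡     = sym (sum-zero {N} _ (λ a → sum-zero {N} _ (λ b →
                   trans (cong (λ x → ind (a ≺ b ∧ (x ∧ (S b ∧ A a b)))) (size≡0 S |S|≡0 a))
                         (cong ind (∧-zeroʳ (a ≺ b))))))
    ; edge     = λ ()
    ; edge-in  = λ ()
    ; complete = λ a _ Sa _ _ → ⊥-elim (false≢true (trans (sym (size≡0 S |S|≡0 a)) Sa))
    }

  addVertex : ∀ S v → S v ≡ true → EdgeList (S ─ v) → EdgeList S
  addVertex S v Sv L′ = record
    { len      = len′ + deg S′ v
    ; len≡     = trans (cong (_+ deg S′ v) (EdgeList.len≡ L′)) (sym (edges-─ S v Sv))
    ; edge     = edge
    ; edge-in  = edge-in
    ; complete = complete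
    }
    where
    S′ = S ─ v
    len′ = EdgeList.len L′
    nbr : VSet
    nbr b = S′ b ∧ A v b
    old+new : Fin len′ ⊎ Fin (deg S′ v) → Fin N × Fin N
    old+new = [ EdgeList.edge L′ , (λ j → v , enum nbr j) ]
    edge : Fin (len′ + deg S′ v) → Fin N × Fin N
    edge i = old+new (splitAt len′ i)
    edge-in : ∀ i → S (proj₁ (edge i)) ≡ true × S (proj₂ (edge i)) ≡ true ×
                    A (proj₁ (edge i)) (proj₂ (edge i)) ≡ true
    edge-in i with splitAt len′ i
    ... | inj₁ j = let (S′a , S′b , ab) = EdgeList.edge-in L′ j in ─-⊆ S v _ S′a , ─-⊆ S v _ S′b , ab
    ... | inj₂ j = let (S′b , vb) = ∧-elim (enum-sound nbr j) in Sv , ─-⊆ S v _ S′b , vb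
    atNew : ∀ b → b ≢ v → S b ≡ true → A v b ≡ true → ∃ λ i → v ∈ₑ edge i × b ∈ₑ edge i
    atNew b b≢v Sb vb with enum-complete nbr b (∧-intro (trans (─-other S v b b≢v) Sb) vb)
    ... | j , e = len′ ↑ʳ j , pair-endpoints (trans (cong old+new (splitAt-↑ʳ len′ _ j)) (cong (v ,_) e))
    complete : ∀ a b → S a ≡ true → S b ≡ true → A a b ≡ true → ∃ λ i → a ∈ₑ edge i × b ∈ₑ edge i
    complete a b Sa Sb ab with a Fin.≟ v | b Fin.≟ v
    ... | yes refl | yes refl = ⊥-elim (false≢true (trans (sym (adj-irrefl G a)) ab))
    ... | yes refl | no b≢v   = atNew b b≢v Sb ab
    ... | no a≢v   | yes refl = let (i , v∈ , a∈) = atNew a a≢v Sa (trans (adj-sym G b a) ab) in i , a∈ , v∈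
    ... | no a≢v   | no b≢v
      with EdgeList.complete L′ a b (trans (─-other S v a a≢v) Sa) (trans (─-other S v b b≢v) Sb) ab
    ...   | j , a∈b∈ = j ↑ˡ deg S′ v , subst (λ p → a ∈ₑ p × b ∈ₑ p)
                                            (sym (cong old+new (splitAt-↑ˡ len′ j (deg S′ v)))) a∈b∈

  someEdgeList : ∀ s S → size S ≡ s → EdgeList S
  someEdgeList zero    S |S|≡0 = noEdges S |S|≡0
  someEdgeList (suc s) S |S|≡s+1
    with sum-pos (ind ∘ S) (subst (1 ≤_) (sym |S|≡s+1) (s≤s z≤n))
  ... | v , 1≤Sv = addVertex S v Sv (someEdgeList s (S ─ v) (suc-injective (trans (sym (size-─ S v Sv)) |S|≡s+1)))
    where
    Sv : S v ≡ true
    Sv = ind-pos 1≤Sv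

  record EliminationOrder (S : VSet) : Set where
    field
      edgeList : EdgeList S
      pos      : Fin N → ℕ
      pos<     : ∀ v → S v ≡ true → pos v < size S
      pos-onto : ∀ r → r < size S → ∃ λ v → S v ≡ true × pos v ≡ r
      early    : ∀ i x → x ∈ₑ EdgeList.edge edgeList i → pos x ≤ suc (toℕ i)
    open EdgeList edgeList public

  noOrder : ∀ S → size S ≡ 0 → EliminationOrder S
  noOrder S |S|≡0 = record
    { edgeList = noEdges S |S|≡0
    ; pos      = λ _ → 0
    ; pos<     = λ v Sv → ⊥-elim (false≢true (trans (sym (size≡0 S |S|≡0 v)) Sv))
    ; pos-onto = λ r r<|S| → ⊥-elim (n≮0 (subst (r <_) |S|≡0 r<|S|))
    ; early    = λ ()
    }

  -- Appending v as the last vertex keeps the order valid provided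
  -- |S| ≤ |E(G[S ─ v])| + 2, i.e. the vertices of S ─ v are numbered no later
  -- than the first new edge allows.
  addLast : ∀ S v → S v ≡ true → EliminationOrder (S ─ v) → size S ≤ 2 + edges (S ─ v) →
            EliminationOrder S
  addLast S v Sv O′ |S|≤ = record
    { edgeList = addVertex S v Sv (EliminationOrder.edgeList O′)
    ; pos      = pos
    ; pos<     = pos<
    ; pos-onto = pos-onto
    ; early    = early
    }
    where
    open EliminationOrder O′ using (len; len≡; edge; edge-in)
      renaming (pos to pos′; pos< to pos′<; pos-onto to pos′-onto; early to early′)
    S′ = S ─ v
    |S|≡ : size S ≡ suc (size S′)
    |S|≡ = size-─ S v Sv
    |S′|≤ : size S′ ≤ suc len
    |S′|≤ = subst (λ e → size S′ ≤ suc e) (sym len≡)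
                  (≤-pred (subst (_≤ 2 + edges S′) |S|≡ |S|≤))
    pos : Fin N → ℕ
    pos w = if w == v then size S′ else pos′ w
    pos-v : pos v ≡ size S′
    pos-v rewrite ==-refl v = refl
    pos-old : ∀ w → S′ w ≡ true → pos w ≡ pos′ w
    pos-old w S′w rewrite ==-≢ (─-≢ S v w S′w) = refl
    pos< : ∀ w → S w ≡ true → pos w < size S
    pos< w Sw with w Fin.≟ v
    ... | yes refl = ≤-reflexive (sym |S|≡)
    ... | no  w≢v  = subst (pos′ w <_) (sym |S|≡) (m≤n⇒m≤1+n (pos′< w (trans (─-other S v w w≢v) Sw)))
    pos-onto : ∀ r → r < size S → ∃ λ w → S w ≡ true × pos w ≡ r
    pos-onto r r<|S| with r ≟ size S′
    ... | yes refl = v , Sv , pos-v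
    ... | no  r≢   with pos′-onto r (≤∧≢⇒< (≤-pred (subst (r <_) |S|≡ r<|S|)) r≢)
    ...   | w , S′w , pw = w , ─-⊆ S v w S′w , trans (pos-old w S′w) pw
    early-v : pos v ≤ suc len
    early-v = subst (_≤ suc len) (sym pos-v) |S′|≤
    early-S′ : ∀ w → S′ w ≡ true → pos w ≤ suc len
    early-S′ w S′w = subst (_≤ suc len) (sym (pos-old w S′w)) (≤-trans (<⇒≤ (pos′< w S′w)) |S′|≤)
    early : ∀ i x → x ∈ₑ EdgeList.edge (addVertex S v Sv (EliminationOrder.edgeList O′)) i →
            pos x ≤ suc (toℕ i)
    early i x x∈ with splitAt len i in split
    ... | inj₁ j = subst₂ (λ p k → p ≤ suc k) (sym (pos-old x (endpoint-in x∈)))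
                          (sym (toℕ-splitAt-inj₁ len split)) (early′ j x x∈)
      where
      endpoint-in : x ∈ₑ edge j → S′ x ≡ true
      endpoint-in (inj₁ refl) = proj₁ (edge-in j)
      endpoint-in (inj₂ refl) = proj₁ (proj₂ (edge-in j))
    ... | inj₂ j = ≤-trans (new x∈)
                     (s≤s (subst (len ≤_) (sym (toℕ-splitAt-inj₂ len split)) (m≤m+n len (toℕ j))))
      where
      new : x ∈ₑ (v , enum (λ b → S′ b ∧ A v b) j) → pos x ≤ suc len
      new (inj₁ refl) = early-v
      new (inj₂ refl) = early-S′ x (proj₁ (∧-elim (enum-sound (λ b → S′ b ∧ A v b) j)))

  -- Deleting vertices of minimum degree one by one yields an elimination
  -- order of S whenever |S| ≤ |E(G[S])| + 1; by degree averaging this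
  -- inequality survives each deletion.
  minDegreeOrder : ∀ s S → size S ≡ s → size S ≤ suc (edges S) → EliminationOrder S
  minDegreeOrder zero    S |S|≡0 _ = noOrder S |S|≡0
  minDegreeOrder (suc s) S |S|≡s+1 |S|≤ with argmin S (deg S)
  ... | inj₂ none = ⊥-elim (0≢1+n (trans (sym (sum-zero (ind ∘ S) (cong ind ∘ none))) |S|≡s+1))
  ... | inj₁ (v , Sv , minimal) =
        addLast S v Sv (minDegreeOrder s S′ |S′|≡s |S′|≤) |S|≤edges+2
    where
    S′ = S ─ v
    δ = deg S v
    |S′|≡s : size S′ ≡ s
    |S′|≡s = suc-injective (trans (sym (size-─ S v Sv)) |S|≡s+1)
    edges≡ : edges S ≡ edges S′ + δ
    edges≡ = trans (edges-─ S v Sv) (cong (edges S′ +_) (deg-─ S v))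
    δ≤deg : ∀ w → ind (S w) * δ ≤ ind (S w) * deg S w
    δ≤deg w with S w in Sw
    ... | true  = +-monoˡ-≤ 0 (minimal w Sw)
    ... | false = z≤n
    average : size S * δ ≤ edges S + edges S
    average = begin
      size S * δ                         ≡⟨ *-distribʳ-sum δ (ind ∘ S) ⟩
      sum (λ w → ind (S w) * δ)          ≤⟨ sum-mono δ≤deg ⟩
      sum (λ w → ind (S w) * deg S w)    ≡⟨ handshake S ⟩
      edges S + edges S                  ∎
      where open ≤-Reasoning
    |S|≤edges+2 : size S ≤ 2 + edges S′
    |S|≤edges+2 = minDegree-deletion (size S) (edges S′) δ
      (subst (λ e → size S ≤ suc e) edges≡ |S|≤) (subst (λ e → size S * δ ≤ e + e) edges≡ average)
    |S′|≤ : size S′ ≤ suc (edges S′)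
    |S′|≤ = ≤-pred (subst (_≤ 2 + edges S′) (size-─ S v Sv) |S|≤edges+2)

  fullOrder : N ≤ suc (∣E∣ G) → EliminationOrder full
  fullOrder n≤ = minDegreeOrder (size full) full refl
                   (subst₂ (λ m e → m ≤ suc e) (sym size-full) ∣E∣≡edges n≤)

  fullOrderIsolated : ∀ u → IsolatedVertex G u → N ≤ 2 + ∣E∣ G → EliminationOrder full
  fullOrderIsolated u isolated n≤ =
    addLast full u refl (minDegreeOrder (size full′) full′ refl |full′|≤) |full|≤
    where
    full′ = full ─ u
    deg≡0 : deg full′ u ≡ 0
    deg≡0 = trans (deg-─ full u) (sum-zero {N} _ (cong ind ∘ isolated))
    edges≡ : edges full′ ≡ ∣E∣ G
    edges≡ = begin
      edges full′                    ≡⟨ sym (+-identityʳ _) ⟩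
      edges full′ + 0                ≡⟨ cong (edges full′ +_) (sym deg≡0) ⟩
      edges full′ + deg full′ u      ≡⟨ sym (edges-─ full u refl) ⟩
      edges full                     ≡⟨ sym ∣E∣≡edges ⟩
      ∣E∣ G                          ∎
      where open ≡-Reasoning
    |full|≤ : size full ≤ 2 + edges full′
    |full|≤ = subst₂ (λ m e → m ≤ 2 + e) (sym size-full) (sym edges≡) n≤
    |full′|≤ : size full′ ≤ suc (edges full′)
    |full′|≤ = ≤-pred (subst (_≤ 2 + edges full′) (size-─ full u refl) |full|≤)

module Padding (G : Graph) (k : ℕ) where

  adjPlus-sound : ∀ x y → adjPlus G k x y ≡ true →
    ∃ λ x′ → ∃ λ y′ → splitAt (n G) x ≡ inj₁ x′ × splitAt (n G) y ≡ inj₁ y′ × adj G x′ y′ ≡ true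
  adjPlus-sound x y xy with splitAt (n G) x | splitAt (n G) y
  ... | inj₁ x′ | inj₁ y′ = x′ , y′ , refl , refl , xy

  adjPlus-complete : ∀ x y x′ y′ → splitAt (n G) x ≡ inj₁ x′ → splitAt (n G) y ≡ inj₁ y′ →
                     adj G x′ y′ ≡ true → adjPlus G k x y ≡ true
  adjPlus-complete x y x′ y′ x≡ y≡ x′y′ with splitAt (n G) x | splitAt (n G) y
  adjPlus-complete x y x′ y′ refl refl x′y′ | .(inj₁ x′) | .(inj₁ y′) = x′y′

  adjPlus-≢ : ∀ x y → adjPlus G k x y ≡ true → x ≢ y
  adjPlus-≢ x .x xx refl with adjPlus-sound x x xx
  ... | x′ , y′ , x≡ , y≡ , x′y′ with trans (sym x≡) y≡
  ...   | refl = false≢true (trans (sym (adj-irrefl G x′)) x′y′)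

  adjPlus-↑ˡ : ∀ x y → adjPlus G k (x ↑ˡ k) (y ↑ˡ k) ≡ adj G x y
  adjPlus-↑ˡ x y rewrite splitAt-↑ˡ (n G) x k | splitAt-↑ˡ (n G) y k = refl

-- Given an elimination order of G whose edge list has len
-- edges, and k with len + 2 ≤ n + k, G ∪ I_k is a competition graph: put
-- vertex x at slot pos x and the j-th added vertex at slot n + j; the two
-- endpoints of edge i both prey on the vertex at slot i + 2.  Arcs go from
-- smaller to larger slots, so the digraph is acyclic.
module Realization (G : Graph) (k : ℕ) (O : Elimination.EliminationOrder G (Induced.full G))
                   (room : suc (suc (Elimination.EliminationOrder.len O)) ≤ n G + k) where
  open Induced G
  open Elimination G
  open EliminationOrder O
  open Padding G k

  place : Fin N ⊎ Fin k → ℕ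
  place = [ pos , (λ j → N + toℕ j) ]

  slot : Fin (N + k) → ℕ
  slot y = place (splitAt N y)

  slot-onto : ∀ σ → σ < N + k → ∃ λ y → slot y ≡ σ
  slot-onto σ σ< with σ <? N
  ... | yes σ<N with pos-onto σ (subst (σ <_) (sym size-full) σ<N)
  ...   | x , _ , pos≡ = x ↑ˡ k , trans (cong place (splitAt-↑ˡ N x k)) pos≡
  slot-onto σ σ< | no σ≮N =
    N ↑ʳ fromℕ< j< , trans (cong place (splitAt-↑ʳ N k _))
                           (trans (cong (N +_) (toℕ-fromℕ< j<)) (m+[n∸m]≡n N≤σ))
    where
    N≤σ : N ≤ σ
    N≤σ = ≮⇒≥ σ≮N
    j< : σ ∸ N < k
    j< = +-cancelˡ-< N (σ ∸ N) k (subst (_< N + k) (sym (m+[n∸m]≡n N≤σ)) σ<)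

  hunts : Fin N → ℕ → Bool
  hunts x (suc (suc r)) with r <? len
  ... | yes r<len = x ∈ₑ? edge (fromℕ< r<len)
  ... | no  _     = false
  hunts x _ = false

  hunts-sound : ∀ x σ → hunts x σ ≡ true → ∃ λ i → σ ≡ suc (suc (toℕ i)) × x ∈ₑ edge i
  hunts-sound x (suc (suc r)) h with r <? len
  ... | yes r<len = fromℕ< r<len , cong (suc ∘ suc) (sym (toℕ-fromℕ< r<len)) , ∈ₑ?-sound x _ h

  hunts-complete : ∀ x i → x ∈ₑ edge i → hunts x (suc (suc (toℕ i))) ≡ true
  hunts-complete x i x∈ with toℕ i <? len
  ... | yes i<len = ∈ₑ?-complete x _ (subst (λ j → x ∈ₑ edge j) (sym (fromℕ<-toℕ i i<len)) x∈)
  ... | no  i≮len = ⊥-elim (i≮len (toℕ<n i))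

  D : Fin (N + k) → Fin (N + k) → Bool
  D x y = [ (λ x′ → hunts x′ (slot y)) , (λ _ → false) ] (splitAt N x)

  D-sound : ∀ x y → D x y ≡ true →
    ∃ λ x′ → splitAt N x ≡ inj₁ x′ × ∃ λ i → slot y ≡ suc (suc (toℕ i)) × x′ ∈ₑ edge i
  D-sound x y xy with splitAt N x
  ... | inj₁ x′ = x′ , refl , hunts-sound x′ (slot y) xy

  D-complete : ∀ x y x′ i → splitAt N x ≡ inj₁ x′ → slot y ≡ suc (suc (toℕ i)) → x′ ∈ₑ edge i →
               D x y ≡ true
  D-complete x y x′ i x≡ y≡ x′∈ =
    subst₂ (λ s σ → [ (λ x′ → hunts x′ σ) , (λ _ → false) ] s ≡ true) (sym x≡) (sym y≡)
           (hunts-complete x′ i x′∈)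

  D-increasing : ∀ x y → D x y ≡ true → slot x < slot y
  D-increasing x y xy with D-sound x y xy
  ... | x′ , x≡ , i , y≡ , x′∈ =
    subst₂ _<_ (sym (cong place x≡)) (sym y≡) (s≤s (early i x′ x′∈))

  acyclic : Acyclic D
  acyclic v cycle = <-irrefl refl (increasing cycle)
    where
    increasing : ∀ {x y} → TransClosure (λ a b → D a b ≡ true) x y → slot x < slot y
    increasing [ xy ]⁺     = D-increasing _ _ xy
    increasing (xy ∷ rest) = <-trans (D-increasing _ _ xy) (increasing rest)

  competition : IsCompetitionGraphOf (adjPlus G k) D
  competition x y x≢y = common-prey , adjacent
    where
    common-prey : adjPlus G k x y ≡ true → ∃ λ v → D x v ≡ true × D y v ≡ true
    common-prey xy with adjPlus-sound x y xy
    ... | x′ , y′ , x≡ , y≡ , x′y′ with complete x′ y′ refl refl x′y′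
    ...   | i , x′∈ , y′∈ with slot-onto (suc (suc (toℕ i))) (≤-trans (s≤s (s≤s (toℕ<n i))) room)
    ...     | v , v≡ = v , D-complete x v x′ i x≡ v≡ x′∈ , D-complete y v y′ i y≡ v≡ y′∈
    adjacent : (∃ λ v → D x v ≡ true × D y v ≡ true) → adjPlus G k x y ≡ true
    adjacent (v , xv , yv) with D-sound x v xv | D-sound y v yv
    ... | x′ , x≡ , i , v≡i , x′∈ | y′ , y≡ , j , v≡j , y′∈
      with toℕ-injective (suc-injective (suc-injective (trans (sym v≡i) v≡j)))
    ...   | refl =
      adjPlus-complete x y x′ y′ x≡ y≡ (endpoints-adjacent edgeList i x′ y′ x′∈ y′∈ x′≢y′)
      where
      x′≢y′ : x′ ≢ y′
      x′≢y′ refl = x≢y (trans (sym (splitAt⁻¹-↑ˡ x≡)) (splitAt⁻¹-↑ˡ y≡))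

  realizable : CompRealizable G k
  realizable = D , acyclic , competition

-- If T had none, walking backwards along in-arcs
-- inside T for m steps would, by pigeonhole, revisit a vertex and so close a
-- directed cycle.
module Sources {m : ℕ} (R : Fin m → Fin m → Bool) (acyclic : Acyclic R) (T : Fin m → Bool) where

  _⇢_ : Fin m → Fin m → Set
  x ⇢ y = R x y ≡ true

  IsSource : Fin m → Set
  IsSource s = T s ≡ true × (∀ u → T u ≡ true → R u s ≡ false)

  isSource? : ∀ s → Dec (IsSource s)
  isSource? s = (T s ≟ᵇ true) ×-dec all? (λ u → (T u ≟ᵇ true) →-dec (R u s ≟ᵇ false))

  predecessor : ¬ (∃ IsSource) → ∀ x → T x ≡ true → ∃ λ u → T u ≡ true × R u x ≡ true
  predecessor none x Tx
    with ¬∀⟶∃¬ m (λ u → T u ≡ true → R u x ≡ false) (λ u → (T u ≟ᵇ true) →-dec (R u x ≟ᵇ false))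
                 (λ noArc → none (x , Tx , noArc))
  ... | u , arc? with T u in Tu | R u x in ux
  ...   | false | _     = ⊥-elim (arc? (λ ()))
  ...   | true  | false = ⊥-elim (arc? (λ _ → refl))
  ...   | true  | true  = u , Tu , ux

  noSource⇒cycle : ¬ (∃ IsSource) → ∀ w → T w ≡ true → ∃ λ v → TransClosure _⇢_ v v
  noSource⇒cycle none w Tw = vertex (toℕ i) , cycle
    where
    step : (∃ λ x → T x ≡ true) → ∃ λ x → T x ≡ true
    step (x , Tx) = let (u , Tu , _) = predecessor none x Tx in u , Tu
    step-arc : ∀ p → proj₁ (step p) ⇢ proj₁ p
    step-arc (x , Tx) = proj₂ (proj₂ (predecessor none x Tx))
    walk : ℕ → ∃ λ x → T x ≡ true
    walk zero    = w , Tw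
    walk (suc i) = step (walk i)
    vertex : ℕ → Fin m
    vertex = proj₁ ∘ walk
    path : ∀ i d → TransClosure _⇢_ (vertex (suc d + i)) (vertex i)
    path i zero    = [ step-arc (walk i) ]⁺
    path i (suc d) = step-arc (walk (suc d + i)) ∷ path i d
    repeat = pigeonhole (n<1+n m) (vertex ∘ toℕ)
    i = proj₁ repeat
    j = proj₁ (proj₂ repeat)
    gap : suc (toℕ j ∸ suc (toℕ i)) + toℕ i ≡ toℕ j
    gap = trans (sym (+-suc _ (toℕ i))) (m∸n+n≡m (proj₁ (proj₂ (proj₂ repeat))))
    cycle : TransClosure _⇢_ (vertex (toℕ i)) (vertex (toℕ i))
    cycle = subst (λ x → TransClosure _⇢_ x (vertex (toℕ i)))
                  (trans (cong vertex gap) (sym (proj₂ (proj₂ (proj₂ repeat)))))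
                  (path (toℕ i) (toℕ j ∸ suc (toℕ i)))

  source : ∀ w → T w ≡ true → ∃ IsSource
  source w Tw with any? isSource?
  ... | yes found = found
  ... | no  none  = let (v , cycle) = noSource⇒cycle none w Tw in ⊥-elim (acyclic v cycle)

other : ∀ {m} → Fin (suc (suc m)) → Fin (suc (suc m))
other Fin.zero    = Fin.suc Fin.zero
other (Fin.suc _) = Fin.zero

other≢ : ∀ {m} (x : Fin (suc (suc m))) → other x ≢ x
other≢ Fin.zero    ()
other≢ (Fin.suc _) ()

twoSources : ∀ {m} (R : Fin m → Fin m → Bool) → Acyclic R → 2 ≤ m →
  ∃ λ s₁ → ∃ λ s₂ → s₁ ≢ s₂ × (∀ u → R u s₁ ≡ false) × (∀ u → R u s₂ ≡ true → u ≡ s₁)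
twoSources {suc zero} R acyclic (s≤s ())
twoSources {suc (suc m)} R acyclic _
  with Sources.source R acyclic (λ _ → true) Fin.zero refl
... | s₁ , _ , s₁-source
  with Sources.source R acyclic (λ v → not (v == s₁)) (other s₁) (cong not (==-≢ (other≢ s₁)))
...   | s₂ , s₂≢s₁ , s₂-source = s₁ , s₂ , s₁≢s₂ , (λ u → s₁-source u refl) , only-s₁
  where
  s₁≢s₂ : s₁ ≢ s₂
  s₁≢s₂ refl = false≢true (trans (sym (cong not (==-refl s₁))) s₂≢s₁)
  only-s₁ : ∀ u → R u s₂ ≡ true → u ≡ s₁
  only-s₁ u us₂ with u Fin.≟ s₁
  ... | yes u≡s₁ = u≡s₁
  ... | no  u≢s₁ = ⊥-elim (false≢true (trans (sym (s₂-source u (cong not (==-≢ u≢s₁)))) us₂))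

reverse⁺ : ∀ {m} {R : Fin m → Fin m → Set} {x y} → TransClosure (λ a b → R b a) x y → TransClosure R y x
reverse⁺ [ xy ]⁺      = [ xy ]⁺
reverse⁺ (xy ∷ rest) = reverse⁺ rest ∷ʳ xy

sink : ∀ {m} (R : Fin m → Fin m → Bool) → Acyclic R → Fin m → ∃ λ s → ∀ u → R s u ≡ false
sink R acyclic w with Sources.source (λ x y → R y x) (λ v → acyclic v ∘ reverse⁺) (λ _ → true) w refl
... | s , _ , noOutArc = s , λ u → noOutArc u refl

module Cliques (G : Graph) where
  open Induced G

  edges-subsingleton : ∀ C → (∀ a b → C a ≡ true → C b ≡ true → a ≡ b) → edges C ≡ 0
  edges-subsingleton C single = sum-zero {N} _ (λ a → sum-zero {N} _ (λ b → noPair a b))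
    where
    noPair : ∀ a b → ind (a ≺ b ∧ (C a ∧ (C b ∧ A a b))) ≡ 0
    noPair a b with a ≺ b ∧ (C a ∧ (C b ∧ A a b)) in pair
    ... | false = refl
    ... | true  = let (a≺b , rest) = ∧-elim pair ; (Ca , Cb∧ab) = ∧-elim rest in
                  ⊥-elim (≺⇒≢ a b a≺b (single a b Ca (proj₁ (∧-elim Cb∧ab))))

  edges≤cover : ∀ {t} (C : Fin t → VSet) →
                (∀ a b → A a b ≡ true → ∃ λ i → C i a ≡ true × C i b ≡ true) →
                ∣E∣ G ≤ sum (λ i → edges (C i))
  edges≤cover {t} C covers = begin
      ∣E∣ G
    ≡⟨ ∣E∣≡edges ⟩
      sum (λ a → sum (λ b → ind (a ≺ b ∧ A a b)))
    ≤⟨ sum-mono (λ a → sum-mono (λ b → pointwise a b)) ⟩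
      sum (λ a → sum (λ b → sum (inside a b)))
    ≡⟨ trans (sum-cong-≗ (λ a → ∑-comm (inside a))) (∑-comm (λ a i → sum (λ b → inside a b i))) ⟩
      sum (λ i → edges (C i)) ∎
    where
    open ≤-Reasoning
    inside : Fin N → Fin N → Fin t → ℕ
    inside a b i = ind (a ≺ b ∧ (C i a ∧ (C i b ∧ A a b)))
    pointwise : ∀ a b → ind (a ≺ b ∧ A a b) ≤ sum (inside a b)
    pointwise a b with a ≺ b ∧ A a b in edge
    ... | false = z≤n
    ... | true with ∧-elim edge
    ...   | a≺b , ab with covers a b ab
    ...     | i , Cia , Cib = subst (_≤ sum (inside a b)) inside≡1 (term≤sum (inside a b) i)
      where
      inside≡1 : inside a b i ≡ 1
      inside≡1 = cong ind (∧-intro a≺b (∧-intro Cia (∧-intro Cib ab)))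

  module _ (triangleFree : TriangleFree G) where

    edges-clique : ∀ C → IsClique G C → edges C ≤ 1
    edges-clique C clique = sum-atMostOne _ (λ a → row≤1 a) rows-unique
      where
      noTriangle : ∀ x y z → x ≢ y → y ≢ z → x ≢ z → C x ≡ true → C y ≡ true → C z ≡ true → ⊥
      noTriangle x y z x≢y y≢z x≢z Cx Cy Cz =
        triangleFree x y z (clique x y x≢y Cx Cy) (clique y z y≢z Cy Cz) (clique x z x≢z Cx Cz)
      pair : ∀ a b → 1 ≤ ind (a ≺ b ∧ (C a ∧ (C b ∧ A a b))) →
             (a ≺ b) ≡ true × C a ≡ true × C b ≡ true
      pair a b counted = let (a≺b , rest) = ∧-elim (ind-pos counted) ; (Ca , Cb∧ab) = ∧-elim rest in
                         a≺b , Ca , proj₁ (∧-elim Cb∧ab)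
      row : Fin N → Fin N → ℕ
      row a b = ind (a ≺ b ∧ (C a ∧ (C b ∧ A a b)))
      -- The edges a b and a b′ with a ≺ b, b′ coincide, else a b b′ is a triangle.
      row≤1 : ∀ a → sum (row a) ≤ 1
      row≤1 a = sum-atMostOne _ (λ b → ind≤1 _) unique
        where
        unique : ∀ b b′ → 1 ≤ row a b → 1 ≤ row a b′ → b ≡ b′
        unique b b′ p q with b Fin.≟ b′ | pair a b p | pair a b′ q
        ... | yes b≡b′ | _ | _ = b≡b′
        ... | no  b≢b′ | a≺b , Ca , Cb | a≺b′ , _ , Cb′ =
          ⊥-elim (noTriangle a b b′ (≺⇒≢ a b a≺b) b≢b′ (≺⇒≢ a b′ a≺b′) Ca Cb Cb′)
      -- Two edges a b and a′ b′ with a ≠ a′ would give a triangle on a, a′ and b or b′.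
      rows-unique : ∀ a a′ → 1 ≤ sum (row a) → 1 ≤ sum (row a′) → a ≡ a′
      rows-unique a a′ p q with a Fin.≟ a′ | sum-pos (row a) p | sum-pos (row a′) q
      ... | yes a≡a′ | _ | _ = a≡a′
      ... | no  a≢a′ | b , rb | b′ , rb′ with pair a b rb | pair a′ b′ rb′ | b Fin.≟ a′
      ...   | a≺b , Ca , Cb | _ , Ca′ , _ | no b≢a′ =
              ⊥-elim (noTriangle a b a′ (≺⇒≢ a b a≺b) b≢a′ a≢a′ Ca Cb Ca′)
      ...   | a≺a′ , Ca , _ | a′≺b′ , Ca′ , Cb′ | yes refl =
              ⊥-elim (noTriangle a a′ b′ a≢a′ (≺⇒≢ a′ b′ a′≺b′) a≢b′ Ca Ca′ Cb′)
        where
        a≢b′ : a ≢ b′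
        a≢b′ refl = false≢true (trans (sym (≺-asym a a′ a≺a′)) a′≺b′)

module Bounds (G : Graph) where
  open Induced G
  open Elimination G
  open Cliques G

  edgeCover : HasEdgeCliqueCoverOfSize G (∣E∣ G)
  edgeCover = subst (HasEdgeCliqueCoverOfSize G) (trans len≡ (sym ∣E∣≡edges)) (F , cliques , covers)
    where
    L = someEdgeList (size full) full refl
    open EdgeList L
    F : Fin len → VSet
    F i x = x ∈ₑ? edge i
    cliques : ∀ i → IsClique G (F i)
    cliques i x y x≢y x∈ y∈ = endpoints-adjacent L i x y (∈ₑ?-sound x _ x∈) (∈ₑ?-sound y _ y∈) x≢y
    covers : ∀ x y → A x y ≡ true → ∃ λ i → F i x ≡ true × F i y ≡ true
    covers x y xy = let (i , x∈ , y∈) = complete x y refl refl xy in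
                    i , ∈ₑ?-complete x _ x∈ , ∈ₑ?-complete y _ y∈

  cover-size : TriangleFree G → ∀ t → HasEdgeCliqueCoverOfSize G t → ∣E∣ G ≤ t
  cover-size triangleFree t (F , cliques , covers) =
    ≤-trans (edges≤cover F covers) (sum-bound _ (λ i → edges-clique triangleFree (F i) (cliques i)))

  -- Opsut's bound k(G) ≥ |E(G)| - n + 2 for triangle-free G with n ≥ 2.  The
  -- hunters of a vertex of D (its in-neighbours in G) form a clique, these
  -- cliques cover E(G), and the hunters of the two sources s₁, s₂ span no edge.
  k-lowerBound : TriangleFree G → 2 ≤ N → ∀ k → CompRealizable G k → suc (suc (∣E∣ G)) ≤ N + k
  k-lowerBound triangleFree 2≤N k (D , acyclic , competition) with twoSources D acyclic (≤-trans 2≤N (m≤m+n N k))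
  ... | s₁ , s₂ , s₁≢s₂ , s₁-source , s₂-in = begin
      suc (suc (∣E∣ G))                          ≤⟨ s≤s (s≤s (edges≤cover hunters covers)) ⟩
      suc (suc (sum (λ v → edges (hunters v))))  ≤⟨ sum-twoZeros _ atMostOne s₁ s₂ s₁≢s₂ none₁ none₂ ⟩
      N + k                                      ∎
    where
    open ≤-Reasoning
    open Padding G k
    hunters : Fin (N + k) → VSet
    hunters v x = D (x ↑ˡ k) v
    ↑ˡ-≢ : ∀ {x y} → x ≢ y → x ↑ˡ k ≢ y ↑ˡ k
    ↑ˡ-≢ {x} {y} x≢y = x≢y ∘ ↑ˡ-injective k x y
    clique : ∀ v → IsClique G (hunters v)
    clique v x y x≢y Dx Dy = trans (sym (adjPlus-↑ˡ x y)) (proj₂ (competition _ _ (↑ˡ-≢ x≢y)) (v , Dx , Dy))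
    covers : ∀ a b → A a b ≡ true → ∃ λ v → hunters v a ≡ true × hunters v b ≡ true
    covers a b ab = let ab⁺ = trans (adjPlus-↑ˡ a b) ab in proj₁ (competition _ _ (adjPlus-≢ _ _ ab⁺)) ab⁺
    atMostOne : ∀ v → edges (hunters v) ≤ 1
    atMostOne v = edges-clique triangleFree (hunters v) (clique v)
    none₁ : edges (hunters s₁) ≡ 0
    none₁ = edges-subsingleton (hunters s₁) (λ a _ Ha _ → ⊥-elim (false≢true (trans (sym (s₁-source _)) Ha)))
    none₂ : edges (hunters s₂) ≡ 0
    none₂ = edges-subsingleton (hunters s₂)
              (λ a b Ha Hb → ↑ˡ-injective k a b (trans (s₂-in _ Ha) (sym (s₂-in _ Hb))))

  neighbour : ∀ x → ¬ IsolatedVertex G x → ∃ λ y → A x y ≡ true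
  neighbour x notIsolated =
    let (y , x≁y) = ¬∀⟶∃¬ N (λ y → A x y ≡ false) (λ y → A x y ≟ᵇ false) notIsolated in y , ¬-not x≁y

  -- Without isolated vertices k(G) ≥ 1: for k = 0 a sink of D is a vertex of G,
  -- so it has a neighbour, with which it would share a prey.
  needsExtraVertex : ¬ HasIsolatedVertex G → 1 ≤ N → ¬ CompRealizable G 0
  needsExtraVertex noIsolated 1≤N (D , acyclic , competition)
    with sink D acyclic (fromℕ< (≤-trans 1≤N (m≤m+n N 0)))
  ... | s , noPrey with splitAt N s in s≡
  ...   | inj₁ x =
    let (y , xy)     = neighbour x (λ isolated → noIsolated (x , isolated))
        sy           = Padding.adjPlus-complete G 0 s (y ↑ˡ 0) x y s≡ (splitAt-↑ˡ N y 0) xy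
        (v , sv , _) = proj₁ (competition s (y ↑ˡ 0) (Padding.adjPlus-≢ G 0 _ _ sy)) sy
    in false≢true (trans (sym (noPrey v)) sv)

  tiny : N ≤ 1 → CompRealizable G 0
  tiny N≤1 = (λ _ _ → false) , noArcs , λ x y x≢y → ⊥-elim (x≢y (atMostOne x y))
    where
    noArcs : Acyclic {N + 0} (λ _ _ → false)
    noArcs v [ () ]⁺
    noArcs v (() ∷ _)
    atMostOne : (x y : Fin (N + 0)) → x ≡ y
    atMostOne = fin≤1 (subst (_≤ 1) (sym (+-identityʳ N)) N≤1)
      where
      fin≤1 : ∀ {m} → m ≤ 1 → (x y : Fin m) → x ≡ y
      fin≤1 {suc zero} _ Fin.zero Fin.zero = refl
      fin≤1 {suc (suc m)} (s≤s ()) _ _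

m∸n≤o⇒m≤n+o : ∀ m n {o} → m ∸ n ≤ o → m ≤ n + o
m∸n≤o⇒m≤n+o m n m∸n≤o = ≤-trans (m≤n+m∸n m n) (+-monoʳ-≤ n m∸n≤o)

tightEquation : ∀ k t v → (ℤ.+ k ≡ (ℤ.+ t ℤ.- ℤ.+ v) ℤ.+ ℤ.+ 2) ⇔ (k + v ≡ 2 + t)
tightEquation k t v = mk⇔ toℕ-equation toℤ-equation
  where
  open ℤSolver
  open ≡-Reasoning
  k′ t′ v′ : ℤ.ℤ
  k′ = ℤ.+ k
  t′ = ℤ.+ t
  v′ = ℤ.+ v
  toℕ-equation : k′ ≡ (t′ ℤ.- v′) ℤ.+ ℤ.+ 2 → k + v ≡ 2 + t
  toℕ-equation eq = ℤ.+-injective (begin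
    ℤ.+ (k + v)                    ≡⟨ ℤ.pos-+ k v ⟩
    k′ ℤ.+ v′                      ≡⟨ cong (ℤ._+ v′) eq ⟩
    (t′ ℤ.- v′) ℤ.+ ℤ.+ 2 ℤ.+ v′   ≡⟨ solve 2 (λ t v → (t :- v) :+ con (ℤ.+ 2) :+ v := con (ℤ.+ 2) :+ t)
                                              refl t′ v′ ⟩
    ℤ.+ 2 ℤ.+ t′                   ≡⟨ sym (ℤ.pos-+ 2 t) ⟩
    ℤ.+ (2 + t)                    ∎)
  toℤ-equation : k + v ≡ 2 + t → k′ ≡ (t′ ℤ.- v′) ℤ.+ ℤ.+ 2
  toℤ-equation eq = begin
    k′                             ≡⟨ solve 2 (λ k v → k := (k :+ v) :- v) refl k′ v′ ⟩
    (k′ ℤ.+ v′) ℤ.- v′             ≡⟨ cong (ℤ._- v′) (trans (sym (ℤ.pos-+ k v))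
                                                             (trans (cong ℤ.+_ eq) (ℤ.pos-+ 2 t))) ⟩
    (ℤ.+ 2 ℤ.+ t′) ℤ.- v′          ≡⟨ solve 2 (λ t v → (con (ℤ.+ 2) :+ t) :- v := (t :- v) :+ con (ℤ.+ 2))
                                              refl t′ v′ ⟩
    (t′ ℤ.- v′) ℤ.+ ℤ.+ 2          ∎

module Tightness (G : Graph) (triangleFree : TriangleFree G) where
  open Induced G
  open Elimination G
  open Bounds G

  E : ℕ
  E = ∣E∣ G

  θ≡E : IsEdgeCliqueCoverNumber G E
  θ≡E = edgeCover , cover-size triangleFree

  competitionNumber : 2 ≤ N → EliminationOrder full → N ≤ 2 + E → IsCompetitionNumber G (2 + E ∸ N)
  competitionNumber 2≤N O N≤ = Realization.realizable G (2 + E ∸ N) O room , minimal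
    where
    room : suc (suc (EliminationOrder.len O)) ≤ N + (2 + E ∸ N)
    room = ≤-reflexive (trans (cong (suc ∘ suc) (trans (EliminationOrder.len≡ O) (sym ∣E∣≡edges)))
                              (sym (m+[n∸m]≡n N≤)))
    minimal : ∀ k → CompRealizable G k → 2 + E ∸ N ≤ k
    minimal k realizable = m≤n+o⇒m∸n≤o (2 + E) N (k-lowerBound triangleFree 2≤N k realizable)

  tight⇒ : CompetitivelyTight G → ∃ λ k → IsCompetitionNumber G k × k + N ≡ 2 + E
  tight⇒ (k , t , kNum , (cover , minimal) , eq) =
    k , kNum , subst (λ t → k + N ≡ 2 + t) t≡E (Equivalence.to (tightEquation k t N) eq)
    where
    t≡E : t ≡ E
    t≡E = ≤-antisym (minimal E edgeCover) (cover-size triangleFree t cover)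

  ⇒tight : 2 ≤ N → EliminationOrder full → N ≤ 2 + E → CompetitivelyTight G
  ⇒tight 2≤N O N≤ = 2 + E ∸ N , E , competitionNumber 2≤N O N≤ , θ≡E ,
                     Equivalence.from (tightEquation (2 + E ∸ N) E N) (m∸n+n≡m N≤)

  -- k(G) + n = |E(G)| + 2 forces n ≥ 2, since k(G) = 0 when n ≤ 1.
  atLeastTwo : ∀ {k} → IsCompetitionNumber G k → k + N ≡ 2 + E → 2 ≤ N
  atLeastTwo {k} (_ , minimal) k+N≡ with 2 ≤? N
  ... | yes 2≤N = 2≤N
  ... | no  2≰N = ⊥-elim (2≰N (subst (2 ≤_) (trans (sym k+N≡) (cong (_+ N) k≡0)) (m≤m+n 2 E)))
    where
    k≡0 : k ≡ 0
    k≡0 = n≤0⇒n≡0 (minimal 0 (tiny (≤-pred (≰⇒> 2≰N))))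

  positive : ∀ {k} → ¬ HasIsolatedVertex G → IsCompetitionNumber G k → 1 ≤ N → 1 ≤ k
  positive {zero}  noIsolated (realizable , _) 1≤N = ⊥-elim (needsExtraVertex noIsolated 1≤N realizable)
  positive {suc k} _ _ _ = s≤s z≤n

  isolated? : Dec (HasIsolatedVertex G)
  isolated? = any? (λ x → all? (λ y → A x y ≟ᵇ false))

mainTheorem3 : (G : Graph) → TriangleFree G →
    CompetitivelyTight G ⇔
      (2 ≤ ∣V∣ G ×
        ((¬ HasIsolatedVertex G × ∣V∣ G ∸ 1 ≤ ∣E∣ G) ⊎
         (HasIsolatedVertex G × ∣V∣ G ∸ 2 ≤ ∣E∣ G)))
mainTheorem3 G triangleFree = mk⇔ necessary sufficient
  where
  open Induced G using (N)
  open Elimination G using (fullOrder; fullOrderIsolated)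
  open Tightness G triangleFree
  Conditions : Set
  Conditions = 2 ≤ N × ((¬ HasIsolatedVertex G × N ∸ 1 ≤ E) ⊎ (HasIsolatedVertex G × N ∸ 2 ≤ E))
  -- Tightness means k(G) + n = |E| + 2; then n ≥ 2, and n ≤ |E| + 1 since
  -- k(G) ≥ 1 when there is no isolated vertex.
  necessary : CompetitivelyTight G → Conditions
  necessary tight with tight⇒ tight
  ... | k , kNum , k+N≡ with atLeastTwo kNum k+N≡ | isolated?
  ...   | 2≤N | yes isolated  = 2≤N , inj₂ (isolated , m≤n+o⇒m∸n≤o N 2 (subst (N ≤_) k+N≡ (m≤n+m N k)))
  ...   | 2≤N | no noIsolated =
            2≤N , inj₁ (noIsolated , m≤n+o⇒m∸n≤o N 1 (≤-pred (subst (suc N ≤_) k+N≡ 1+N≤k+N)))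
    where
    1+N≤k+N : suc N ≤ k + N
    1+N≤k+N = +-monoˡ-≤ N (positive noIsolated kNum (≤-trans (s≤s z≤n) 2≤N))
  sufficient : Conditions → CompetitivelyTight G
  sufficient (2≤N , inj₁ (_ , N∸1≤E)) =
    ⇒tight 2≤N (fullOrder (m∸n≤o⇒m≤n+o N 1 N∸1≤E)) (m≤n⇒m≤1+n (m∸n≤o⇒m≤n+o N 1 N∸1≤E))
  sufficient (2≤N , inj₂ ((u , isolated) , N∸2≤E)) =
    ⇒tight 2≤N (fullOrderIsolated u isolated (m∸n≤o⇒m≤n+o N 2 N∸2≤E)) (m∸n≤o⇒m≤n+o N 2 N∸2≤E)
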